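{- Let $G$ be a finite bipartite graph (multiple edges allowed, no loops), let $e=uv$ be an edge of $G$, and let $j\geq 0$ be an integer. Then for every maximum $j$-edge-colorable subgraph $H_j$ of $G$ with $e\notin E(H_j)$, we have $d_{H_j}(u)=j$ or $d_{H_j}(v)=j$.
   Context: Graphs are finite, undirected, without loops, possibly with multiple edges. For an integer $j\geq 0$, a graph is $j$-edge-colorable if its edges can be assigned colors from a set of $j$ colors so that adjacent edges receive different colors. A $j$-edge-colorable subgraph of $G$ is maximum if it has the largest number of edges among all $j$-edge-colorable subgraphs of $G$. $d_H(x)$ denotes the degree of vertex $x$ in the subgraph $H$ (with $d_H(x)=0$ if $x$ is incident to no edge of $H$). -}

module Defs where

open import Data.Nat using (ℕ; _≤_)
open import Data.Fin using (Fin)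
open import Data.Fin.Subset using (Subset; _∈_; _∩_; ∣_∣)
open import Data.Bool using (Bool; true; false)
open import Data.Vec using (tabulate)
open import Data.Product using (Σ; _×_; _,_)
open import Relation.Binary.PropositionalEquality using (_≡_; _≢_)
open import Relation.Nullary using (¬_)

-- A finite multigraph: vertices Fin n, edges Fin m, each edge with two
-- endpoints (ends e = (x , y)).  Parallel edges are allowed since
-- distinct edge indices may have the same endpoints.
record Multigraph : Set where
  field
    n : ℕ
    m : ℕ
    ends : Fin m → Fin n × Fin n

open Multigraph public

endL : (G : Multigraph) → Fin (m G) → Fin (n G)
endL G e with ends G e
... | (x , _) = x

endR : (G : Multigraph) → Fin (m G) → Fin (n G)
endR G e with ends G e
... | (_ , y) = y

Incident : (G : Multigraph) → Fin (m G) → Fin (n G) → Set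
Incident G e x = (endL G e ≡ x) Data.Sum.⊎ (endR G e ≡ x)
  where import Data.Sum

Loopless : Multigraph → Set
Loopless G = ∀ e → endL G e ≢ endR G e

-- bipartite: a 2-colouring of the vertices in which every edge joins
-- vertices of different sides (this in particular excludes loops)
Bipartite : Multigraph → Set
Bipartite G = Σ (Fin (n G) → Bool) λ side → ∀ e → side (endL G e) ≢ side (endR G e)

-- Subgraphs are identified with their edge sets (spanning subgraphs;
-- isolated vertices do not affect colourability or degrees).
EdgeSet : Multigraph → Set
EdgeSet G = Subset (m G)

Adjacent : (G : Multigraph) → Fin (m G) → Fin (m G) → Set
Adjacent G e f = e ≢ f × Σ (Fin (n G)) λ x → Incident G e x × Incident G f x

EdgeColorable : (G : Multigraph) → ℕ → EdgeSet G → Set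
EdgeColorable G j H =
  Σ (Fin (m G) → Fin j) λ c →
    ∀ e f → e ∈ H → f ∈ H → Adjacent G e f → c e ≢ c f

MaxColorable : (G : Multigraph) → ℕ → EdgeSet G → Set
MaxColorable G j H =
  EdgeColorable G j H × (∀ H' → EdgeColorable G j H' → ∣ H' ∣ ≤ ∣ H ∣)

incidentSet : (G : Multigraph) → Fin (n G) → EdgeSet G
incidentSet G x = tabulate λ e → isInc (endL G e Data.Fin.≟ x) (endR G e Data.Fin.≟ x)
  where
  import Data.Fin
  open import Relation.Nullary using (Dec; yes; no)
  isInc : ∀ {A B : Set} → Dec A → Dec B → Bool
  isInc (yes _) _ = true
  isInc (no _) (yes _) = true
  isInc (no _) (no _) = false

deg : (G : Multigraph) → EdgeSet G → Fin (n G) → ℕ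
deg G H x = ∣ H ∩ incidentSet G x ∣

module Submission where

-- Let H be a maximum j-edge-colourable subgraph of the
-- bipartite graph G with a proper colouring c, and let e = uv ∉ H.  If
-- neither d_H(u) nor d_H(v) equals j, then (as a proper colouring puts at
-- most j edges at a vertex) u misses some colour α and v some colour β.
-- If α = β, colouring e with α makes H + e j-edge-colourable.  Otherwise a
-- Kempe interchange along the α/β-alternating path starting at u makes β
-- missing at u; since G is bipartite and v lies on the other side, v still
-- misses β, and again e can be added.  Either way H + e contradicts the
-- maximality of H.

open import Defs
open import Data.Nat using (ℕ; zero; suc; _<_; _≤_; z≤n) renaming (_≟_ to _≟ℕ_)
open import Data.Nat.Properties using (≤-pred; ≤-trans; ≤-<-trans; ≤-antisym; ≤-refl; <⇒≱)
open import Data.Fin using (Fin; zero; suc; _≟_)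
open import Data.Fin.Properties using (any?; all?; ¬∀⟶∃¬; suc-injective; 0≢1+n)
open import Data.Fin.Subset using (Subset; _∈_; _∉_; _⊆_; _∩_; _∪_; ⁅_⁆; _-_; ⊤; ∣_∣; inside; outside)
open import Data.Fin.Subset.Properties
  using (_∈?_; ∈⊤; ∣⊤∣≡n; x∈p⇒∣p-x∣<∣p∣; x∈p∧x≢y⇒x∈p-y; p─q⊆p; x∈p∩q⁺; x∈p∩q⁻;
         x∈p∪q⁺; x∈p∪q⁻; p⊆p∪q; x∈⁅x⁆; x∈⁅y⁆⇒x≡y; p⊂q⇒∣p∣<∣q∣)
open import Data.Bool using (Bool; true; false)
open import Data.Bool.Properties using (¬-not)
open import Data.Vec using (_∷_; []; lookup; here; there)
open import Data.Vec.Properties using (lookup∘tabulate; []=⇒lookup; lookup⇒[]=)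
open import Data.Product using (∃; _×_; _,_; proj₁; proj₂)
open import Data.Sum using (_⊎_; inj₁; inj₂; [_,_])
open import Data.Empty using (⊥-elim)
open import Function using (_∘_)
open import Relation.Nullary using (¬_; Dec; yes; no)
open import Relation.Nullary.Decidable using (_×-dec_; _⊎-dec_)
open import Relation.Binary.PropositionalEquality using (_≡_; _≢_; refl; sym; trans; cong; subst)

injection⇒∣p∣≤∣q∣ : ∀ {a b} {p : Subset a} {q : Subset b} (f : Fin a → Fin b) →
  (∀ {i} → i ∈ p → f i ∈ q) →
  (∀ {i i'} → i ∈ p → i' ∈ p → f i ≡ f i' → i ≡ i') →
  ∣ p ∣ ≤ ∣ q ∣
injection⇒∣p∣≤∣q∣ {p = []} f into injective = z≤n
injection⇒∣p∣≤∣q∣ {p = outside ∷ p} f into injective =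
  injection⇒∣p∣≤∣q∣ (f ∘ suc) (into ∘ there)
    (λ i∈p i'∈p eq → suc-injective (injective (there i∈p) (there i'∈p) eq))
injection⇒∣p∣≤∣q∣ {p = inside ∷ p} {q} f into injective =
  ≤-<-trans rest (x∈p⇒∣p-x∣<∣p∣ (into here))
  where
  rest : ∣ p ∣ ≤ ∣ q - f zero ∣
  rest = injection⇒∣p∣≤∣q∣ (f ∘ suc)
    (λ i∈p → x∈p∧x≢y⇒x∈p-y (into (there i∈p))
               (λ eq → 0≢1+n (injective here (there i∈p) (sym eq))))
    (λ i∈p i'∈p eq → suc-injective (injective (there i∈p) (there i'∈p) eq))

y∉p-y : ∀ {k} (p : Subset k) (y : Fin k) → y ∉ p - y
y∉p-y (_ ∷ p) zero ()
y∉p-y (_ ∷ p) (suc y) (there y∈p-y) = y∉p-y p y y∈p-y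

both-off-side : ∀ {a b c : Bool} → a ≢ c → b ≢ c → a ≡ b
both-off-side a≢c b≢c = trans (¬-not a≢c) (sym (¬-not b≢c))

module Incidence (G : Multigraph) where

  incident⁻ : ∀ {g x} → g ∈ incidentSet G x → Incident G g x
  incident⁻ {g} {x} g∈ with trans (sym (lookup∘tabulate _ g)) ([]=⇒lookup g∈)
  ... | flagged with endL G g ≟ x | endR G g ≟ x
  ... | yes atL | _       = inj₁ atL
  ... | no _    | yes atR = inj₂ atR
  ... | no _    | no _    with flagged
  ... | ()

  incident⁺ : ∀ {g x} → Incident G g x → g ∈ incidentSet G x
  incident⁺ {g} {x} g-at-x with lookup (incidentSet G x) g in flag
  ... | true  = lookup⇒[]= g _ flag
  ... | false with trans (sym (lookup∘tabulate _ g)) flag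
  ... | unflagged with endL G g ≟ x | endR G g ≟ x
  ... | no notL | no notR = ⊥-elim ([ notL , notR ] g-at-x)
  ... | yes _   | _       with unflagged
  ... | ()
  incident⁺ {g} {x} g-at-x | false | unflagged | no _ | yes _ with unflagged
  ... | ()

  counted⁻ : ∀ {H g x} → g ∈ H ∩ incidentSet G x → g ∈ H × Incident G g x
  counted⁻ {H} g∈ with x∈p∩q⁻ H _ g∈
  ... | g∈H , g∈inc = g∈H , incident⁻ g∈inc

  counted⁺ : ∀ {H g x} → g ∈ H → Incident G g x → g ∈ H ∩ incidentSet G x
  counted⁺ g∈H g-at-x = x∈p∩q⁺ (g∈H , incident⁺ g-at-x)

module Colouring (G : Multigraph) (j : ℕ) where
  open Incidence G

  Vertex : Set
  Vertex = Fin (n G)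

  Edge : Set
  Edge = Fin (m G)

  Colour : Set
  Colour = Fin j

  Proper : EdgeSet G → (Edge → Colour) → Set
  Proper H c = ∀ e f → e ∈ H → f ∈ H → Adjacent G e f → c e ≢ c f

  Present : EdgeSet G → (Edge → Colour) → Vertex → Colour → Set
  Present H c y γ = ∃ λ g → g ∈ H × Incident G g y × c g ≡ γ

  Missing : EdgeSet G → (Edge → Colour) → Vertex → Colour → Set
  Missing H c y γ = ∀ g → g ∈ H → Incident G g y → c g ≢ γ

  present? : ∀ H c y γ → Dec (Present H c y γ)
  present? H c y γ =
    any? λ g → (g ∈? H) ×-dec (((endL G g ≟ y) ⊎-dec (endR G g ≟ y)) ×-dec (c g ≟ γ))

  absent⇒missing : ∀ {H c y γ} → ¬ Present H c y γ → Missing H c y γ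
  absent⇒missing absent g g∈H g-at-y cg≡γ = absent (g , g∈H , g-at-y , cg≡γ)

  proper-⊆ : ∀ {H' H c} → H' ⊆ H → Proper H c → Proper H' c
  proper-⊆ H'⊆H proper g h g∈H' h∈H' = proper g h (H'⊆H g∈H') (H'⊆H h∈H')

  missing-⊆ : ∀ {H' H c y γ} → H' ⊆ H → Missing H c y γ → Missing H' c y γ
  missing-⊆ H'⊆H missing g g∈H' = missing g (H'⊆H g∈H')

  -- In a proper colouring the edges at x have distinct colours: deg x ≤ j.
  deg≤j : ∀ {H c} → Proper H c → ∀ x → deg G H x ≤ j
  deg≤j {H} {c} proper x =
    subst (deg G H x ≤_) (∣⊤∣≡n j) (injection⇒∣p∣≤∣q∣ c (λ _ → ∈⊤) distinct)
    where
    distinct : ∀ {g h} → g ∈ H ∩ incidentSet G x → h ∈ H ∩ incidentSet G x →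
      c g ≡ c h → g ≡ h
    distinct {g} {h} g∈ h∈ cg≡ch with g ≟ h | counted⁻ g∈ | counted⁻ h∈
    ... | yes g≡h | _ | _ = g≡h
    ... | no g≢h | g∈H , g-at-x | h∈H , h-at-x =
      ⊥-elim (proper g h g∈H h∈H (g≢h , x , g-at-x , h-at-x) cg≡ch)

  -- If every colour occurs at x, picking an edge of each colour is
  -- injective, so j ≤ deg x.
  all-present⇒j≤deg : ∀ {H c x} → (∀ γ → Present H c x γ) → j ≤ deg G H x
  all-present⇒j≤deg {H} {c} {x} present =
    subst (_≤ deg G H x) (∣⊤∣≡n j) (injection⇒∣p∣≤∣q∣ edge-of (λ _ → counted) injective)
    where
    edge-of : Colour → Edge
    edge-of γ = proj₁ (present γ)

    colour-of : ∀ γ → c (edge-of γ) ≡ γ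
    colour-of γ = proj₂ (proj₂ (proj₂ (present γ)))

    counted : ∀ {γ} → edge-of γ ∈ H ∩ incidentSet G x
    counted {γ} = counted⁺ (proj₁ (proj₂ (present γ))) (proj₁ (proj₂ (proj₂ (present γ))))

    injective : ∀ {γ γ'} → γ ∈ ⊤ → γ' ∈ ⊤ → edge-of γ ≡ edge-of γ' → γ ≡ γ'
    injective {γ} {γ'} _ _ same = trans (sym (colour-of γ)) (trans (cong c same) (colour-of γ'))

  missing-colour : ∀ {H c} → Proper H c → ∀ x → deg G H x ≢ j → ∃ (Missing H c x)
  missing-colour {H} {c} proper x deg≢j with all? (present? H c x)
  ... | yes all-present =
    ⊥-elim (deg≢j (≤-antisym (deg≤j proper x) (all-present⇒j≤deg all-present)))
  ... | no not-all with ¬∀⟶∃¬ j (Present H c x) (present? H c x) not-all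
  ... | γ , absent = γ , absent⇒missing absent

  recolour : Edge → Colour → (Edge → Colour) → Edge → Colour
  recolour f γ c g with g ≟ f
  ... | yes _ = γ
  ... | no _  = c g

  recolour-missing : ∀ {H H' c f α y γ} → (∀ {g} → g ∈ H → g ≢ f → g ∈ H') →
    Missing H' c y γ → (Incident G f y → α ≢ γ) → Missing H (recolour f α c) y γ
  recolour-missing {f = f} others missing f-ok g g∈H g-at-y with g ≟ f
  ... | yes refl = f-ok g-at-y
  ... | no g≢f   = missing g (others g∈H g≢f) g-at-y

  recolour-proper : ∀ {H H' c f α} → (∀ {g} → g ∈ H → g ≢ f → g ∈ H') → Proper H' c →
    (∀ z → Incident G f z → Missing H' c z α) → Proper H (recolour f α c)
  recolour-proper {f = f} others proper ends-miss g h g∈H h∈H (g≢h , z , g-at-z , h-at-z)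
    with g ≟ f | h ≟ f
  ... | yes refl | yes refl = ⊥-elim (g≢h refl)
  ... | yes refl | no h≢f   = λ eq → ends-miss z g-at-z h (others h∈H h≢f) h-at-z (sym eq)
  ... | no g≢f   | yes refl = λ eq → ends-miss z h-at-z g (others g∈H g≢f) g-at-z eq
  ... | no g≢f   | no h≢f   =
    proper g h (others g∈H g≢f) (others h∈H h≢f) (g≢h , z , g-at-z , h-at-z)

  add-edge : ∀ {H c e γ} → Proper H c →
    Missing H c (endL G e) γ → Missing H c (endR G e) γ → EdgeColorable G j (H ∪ ⁅ e ⁆)
  add-edge {H} {c} {e} {γ} proper u-misses v-misses =
    recolour e γ c , recolour-proper others proper ends-miss
    where
    others : ∀ {g} → g ∈ H ∪ ⁅ e ⁆ → g ≢ e → g ∈ H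
    others {g} g∈ g≢e with x∈p∪q⁻ H ⁅ e ⁆ g∈
    ... | inj₁ g∈H = g∈H
    ... | inj₂ g∈e = ⊥-elim (g≢e (x∈⁅y⁆⇒x≡y e g∈e))

    ends-miss : ∀ z → Incident G e z → Missing H c z γ
    ends-miss z (inj₁ refl) = u-misses
    ends-miss z (inj₂ refl) = v-misses

  maximum-closed : ∀ {H e} → MaxColorable G j H → e ∉ H → ¬ EdgeColorable G j (H ∪ ⁅ e ⁆)
  maximum-closed {H} {e} (_ , maximum) e∉H colourable =
    <⇒≱ (p⊂q⇒∣p∣<∣q∣ (p⊆p∪q ⁅ e ⁆ , e , x∈p∪q⁺ (inj₂ (x∈⁅x⁆ e)) , e∉H))
        (maximum (H ∪ ⁅ e ⁆) colourable)

  -- In a proper colouring, an edge f ∈ H of colour β is the only β-edge at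
  -- its ends, so β is missing there once f is removed.
  sole-colour : ∀ {H c f β z} → Proper H c → f ∈ H → c f ≡ β → Incident G f z →
    Missing (H - f) c z β
  sole-colour {H} {c} {f} {β} {z} proper f∈H cf≡β f-at-z g g∈H-f g-at-z cg≡β =
    proper g f (p─q⊆p H ⁅ f ⁆ g∈H-f) f∈H (g≢f , z , g-at-z , f-at-z) (trans cg≡β (sym cf≡β))
    where
    g≢f : g ≢ f
    g≢f refl = y∉p-y H f g∈H-f

module KempeChain (G : Multigraph) (j : ℕ) (side : Fin (n G) → Bool)
  (bipartite : ∀ e → side (endL G e) ≢ side (endR G e)) where
  open Colouring G j

  record FarEnd (f : Edge) (x : Vertex) : Set where
    field
      w         : Vertex
      at-w      : Incident G f w
      across    : side w ≢ side x
      only-ends : ∀ y → Incident G f y → y ≡ x ⊎ y ≡ w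

  far-end : ∀ {f x} → Incident G f x → FarEnd f x
  far-end {f} (inj₁ refl) = record
    { w = endR G f ; at-w = inj₂ refl ; across = bipartite f ∘ sym
    ; only-ends = λ { y (inj₁ refl) → inj₁ refl ; y (inj₂ refl) → inj₂ refl } }
  far-end {f} (inj₂ refl) = record
    { w = endL G f ; at-w = inj₁ refl ; across = bipartite f
    ; only-ends = λ { y (inj₁ refl) → inj₂ refl ; y (inj₂ refl) → inj₁ refl } }

  -- The outcome of interchanging the colours α, β along the alternating
  -- path starting at x (where α is missing): a new proper colouring in which
  -- x misses β, while β stays missing on the far side of x, α stays missing
  -- on x's own side, and vertices missing both colours keep missing both.
  record Interchange (H : EdgeSet G) (c : Edge → Colour) (x : Vertex) (α β : Colour) : Set where
    field
      colouring     : Edge → Colour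
      proper        : Proper H colouring
      frees         : Missing H colouring x β
      keeps-across  : ∀ y → side y ≢ side x → Missing H c y β → Missing H colouring y β
      keeps-beside  : ∀ y → side y ≡ side x → y ≢ x → Missing H c y α → Missing H colouring y α
      keeps-both    : ∀ y → Missing H c y α → Missing H c y β →
                      Missing H colouring y α × Missing H colouring y β

  unchanged : ∀ {H c x α β} → Proper H c → Missing H c x β → Interchange H c x α β
  unchanged {c = c} proper x-misses-β = record
    { colouring = c ; proper = proper ; frees = x-misses-β
    ; keeps-across = λ _ _ m → m ; keeps-beside = λ _ _ _ m → m ; keeps-both = λ _ a b → a , b }

  -- One link of the chain: if f = xw ∈ H has colour β, interchange β/α from
  -- w in H - f and then give f the colour α.
  extend-chain : ∀ {H c x α β f} → Proper H c → α ≢ β → Missing H c x α →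
    f ∈ H → Incident G f x → c f ≡ β → (far : FarEnd f x) →
    Interchange (H - f) c (FarEnd.w far) β α → Interchange H c x α β
  extend-chain {H} {c} {x} {α} {β} {f} proper α≢β x-misses-α f∈H f-at-x cf≡β far chain = record
    { colouring    = recolour f α R.colouring
    ; proper       = recolour-proper others R.proper ends-miss-α
    ; frees        = recolour-missing others (proj₁ x-both) (λ _ → α≢β)
    ; keeps-across = λ y y-across y-misses-β →
        recolour-missing others
          (R.keeps-beside y (both-off-side y-across across) (y≢w y-misses-β) (rest y-misses-β))
          (λ _ → α≢β)
    ; keeps-beside = λ y y-beside y≢x y-misses-α →
        recolour-missing others
          (R.keeps-across y (λ eq → across (trans (sym eq) y-beside)) (rest y-misses-α))
          (λ f-at-y → ⊥-elim (f-not-beside y y-beside y≢x f-at-y))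
    ; keeps-both   = λ y y-misses-α y-misses-β →
        let both = R.keeps-both y (rest y-misses-β) (rest y-misses-α)
            f-away : ∀ {γ} → Incident G f y → α ≢ γ
            f-away f-at-y = ⊥-elim (y-misses-β f f∈H f-at-y cf≡β)
        in recolour-missing others (proj₂ both) f-away , recolour-missing others (proj₁ both) f-away
    }
    where
    open FarEnd far
    module R = Interchange chain

    others : ∀ {g} → g ∈ H → g ≢ f → g ∈ H - f
    others = x∈p∧x≢y⇒x∈p-y

    rest : ∀ {y γ} → Missing H c y γ → Missing (H - f) c y γ
    rest = missing-⊆ (p─q⊆p H ⁅ f ⁆)

    y≢w : ∀ {y} → Missing H c y β → y ≢ w
    y≢w y-misses-β refl = y-misses-β f f∈H at-w cf≡β

    f-not-beside : ∀ y → side y ≡ side x → y ≢ x → ¬ Incident G f y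
    f-not-beside y y-beside y≢x f-at-y with only-ends y f-at-y
    ... | inj₁ y≡x = y≢x y≡x
    ... | inj₂ refl = across y-beside

    x-both : Missing (H - f) R.colouring x β × Missing (H - f) R.colouring x α
    x-both = R.keeps-both x (sole-colour proper f∈H cf≡β f-at-x) (rest x-misses-α)

    ends-miss-α : ∀ z → Incident G f z → Missing (H - f) R.colouring z α
    ends-miss-α z f-at-z with only-ends z f-at-z
    ... | inj₁ refl = proj₂ x-both
    ... | inj₂ refl = R.frees

  -- The Kempe interchange exists whenever α ≠ β is missing at x; by
  -- induction on the number of edges (bounded by k): either β is missing at
  -- x already, or the β-edge at x is the first link of the chain.
  interchange-bounded : ∀ k {H} → ∣ H ∣ < k → ∀ {c} → Proper H c →
    ∀ {x α β} → α ≢ β → Missing H c x α → Interchange H c x α β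
  interchange-bounded zero () _ _ _
  interchange-bounded (suc k) {H} H<k {c} proper {x} {α} {β} α≢β x-misses-α
    with present? H c x β
  ... | no β-absent = unchanged proper (absent⇒missing β-absent)
  ... | yes (f , f∈H , f-at-x , cf≡β) =
    extend-chain proper α≢β x-misses-α f∈H f-at-x cf≡β far
      (interchange-bounded k (≤-trans (x∈p⇒∣p-x∣<∣p∣ f∈H) (≤-pred H<k))
         (proper-⊆ (p─q⊆p H ⁅ f ⁆) proper) (α≢β ∘ sym)
         (sole-colour proper f∈H cf≡β (FarEnd.at-w far)))
    where
    far : FarEnd f x
    far = far-end f-at-x

  interchange : ∀ {H c} → Proper H c → ∀ {x α β} → α ≢ β → Missing H c x α →
    Interchange H c x α β
  interchange {H} = interchange-bounded (suc ∣ H ∣) ≤-refl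

  -- Key lemma: if the ends of e miss colours α and β, then after possibly
  -- interchanging α/β from the left end both ends miss β, so e can be added.
  extendable : ∀ {H c e α β} → Proper H c →
    Missing H c (endL G e) α → Missing H c (endR G e) β → EdgeColorable G j (H ∪ ⁅ e ⁆)
  extendable {e = e} {α} {β} proper u-misses-α v-misses-β with α ≟ β
  ... | yes refl = add-edge proper u-misses-α v-misses-β
  ... | no α≢β = add-edge I.proper I.frees
                   (I.keeps-across (endR G e) (bipartite e ∘ sym) v-misses-β)
    where
    module I = Interchange (interchange proper α≢β u-misses-α)

lemma1 : (G : Multigraph) → Bipartite G → (e : Fin (m G)) → (j : ℕ) →
    (H : EdgeSet G) → MaxColorable G j H → e ∉ H →
    (deg G H (endL G e) ≡ j) ⊎ (deg G H (endR G e) ≡ j)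
lemma1 G (side , bipartite) e j H maximum@((c , proper) , _) e∉H
  with deg G H (endL G e) ≟ℕ j | deg G H (endR G e) ≟ℕ j
... | yes u-full   | _          = inj₁ u-full
... | no _         | yes v-full = inj₂ v-full
... | no u-unfull  | no v-unfull =
  ⊥-elim (maximum-closed maximum e∉H
    (extendable proper (proj₂ (missing-colour proper (endL G e) u-unfull))
                       (proj₂ (missing-colour proper (endR G e) v-unfull))))
  where
  open Colouring G j
  open KempeChain G j side bipartite
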